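{- Let $m,n$ be positive integers and $b,c\in\mathbb{N}$. Let $\boldsymbol{U}=\{(u_{i,j},v_{i,j}): i,j\in\mathbb{N}\}$ with $u_{i,j}=bj+1$ and $v_{i,j}=ci+1$. Then $$\big|\mathcal{IPF}^{(2)}_{m,n}(\boldsymbol{U})\big|=\frac{1+bn+cm}{(1+bn)(1+cm)}\binom{bn+m}{m}\binom{cm+n}{n}.$$
   Context: For a set $\boldsymbol{U}=\{(u_{i,j},v_{i,j})\}\subset\mathbb{N}^2$ with $u_{i,j}\le u_{i',j'}$, $v_{i,j}\le v_{i',j'}$ whenever $i\le i'$, $j\le j'$: given a lattice path $P=e_1\cdots e_{m+n}$ from $(0,0)$ to $(m,n)$ with steps $E=(1,0)$ and $N=(0,1)$, a pair of sequences $\boldsymbol{a}=(a_0,\dots,a_{m-1})$, $\boldsymbol{b}=(b_0,\dots,b_{n-1})$ is bounded by $P$ with respect to $\boldsymbol{U}$ if for every $r$: when $e_r$ is an $E$-step from $(i,j)$ to $(i+1,j)$ then $a_i<u_{i,j}$, and when $e_r$ is an $N$-step from $(i,j)$ to $(i,j+1)$ then $b_j<v_{i,j}$. $\mathcal{IPF}^{(2)}_{m,n}(\boldsymbol{U})$ is the set of pairs $(\boldsymbol{a},\boldsymbol{b})$ of non-decreasing sequences of non-negative integers, of lengths $m$ and $n$, that are bounded by at least one lattice path from $(0,0)$ to $(m,n)$ with respect to $\boldsymbol{U}$. -}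

module Defs where

open import Data.Nat using (ℕ; zero; suc; _+_; _*_; _≤_; _<_)
open import Data.Vec using (Vec; []; _∷_)
open import Data.Product using (Σ; _×_; ∃)
open import Data.Unit using (⊤)
open import Data.Irrelevant using (Irrelevant)

-- Lattice paths from (0,0) to (m,n) with unit steps E=(1,0) and N=(0,1),
-- written step by step from the start; index = remaining E- and N-steps.
data LPath : ℕ → ℕ → Set where
  done  : LPath 0 0
  east  : ∀ {p q} → LPath p q → LPath (suc p) q
  north : ∀ {p q} → LPath p q → LPath p (suc q)

-- BoundedFrom u v i j as bs P : the path P starts at (i , j); the remaining
-- entries a_i, a_{i+1}, ... are 'as' and b_j, b_{j+1}, ... are 'bs'.
BoundedFrom : (u v : ℕ → ℕ → ℕ) (i j : ℕ) {p q : ℕ} →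
              Vec ℕ p → Vec ℕ q → LPath p q → Set
BoundedFrom u v i j [] [] done = ⊤
BoundedFrom u v i j (x ∷ as) bs (east P) = x < u i j × BoundedFrom u v (suc i) j as bs P
BoundedFrom u v i j as (y ∷ bs) (north P) = y < v i j × BoundedFrom u v i (suc j) as bs P

BoundedBy : (u v : ℕ → ℕ → ℕ) {m n : ℕ} → Vec ℕ m → Vec ℕ n → LPath m n → Set
BoundedBy u v a b P = BoundedFrom u v 0 0 a b P

NonDecreasing : ∀ {k} → Vec ℕ k → Set
NonDecreasing [] = ⊤
NonDecreasing (x ∷ []) = ⊤
NonDecreasing (x ∷ y ∷ xs) = x ≤ y × NonDecreasing (y ∷ xs)

IsIPF2 : (u v : ℕ → ℕ → ℕ) {m n : ℕ} → Vec ℕ m → Vec ℕ n → Set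
IsIPF2 u v {m} {n} a b =
  NonDecreasing a × NonDecreasing b × ∃ (λ (P : LPath m n) → BoundedBy u v a b P)

-- The set IPF^(2)_{m,n}(U): pairs (a , b) together with a proof-irrelevant
-- witness of membership, so that each pair is counted exactly once.
IPF2 : (m n : ℕ) (u v : ℕ → ℕ → ℕ) → Set
IPF2 m n u v = Σ (Vec ℕ m × Vec ℕ n) (λ ab → Irrelevant (IsIPF2 u v (Data.Product.proj₁ ab) (Data.Product.proj₂ ab)))

module Submission where

-- A pair (a , b) is bounded by some lattice path iff at every lattice point
-- (i , j) we have a_i ≤ b j or b_j ≤ c i: such a path is built greedily, going
-- east whenever the next a-entry allows it.  Now count, for all bounds A ≥ b n
-- and B ≥ c m, the non-decreasing pairs with a_i ≤ A, b_j ≤ B and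
-- a_i + b (n - j) ≤ A or b_j + c (m - i) ≤ B.  If a bound is loose, split on
-- whether the first entry of that sequence is 0 (drop it) or positive (lower all
-- entries by 1); if both are tight, the two first entries cannot both be
-- positive.  These recursions are solved by
--   C(A + m, m) C(B + n, n) - b c C(A + m, m - 1) C(B + n, n - 1),
-- and at A = b n, B = c m this is the stated product formula, because
-- m C(A + m, m) = (A + 1) C(A + m, m - 1).

open import Defs
open import Data.Nat using (ℕ; zero; suc; _+_; _*_; _∸_; _≤_; _<_; _≤?_; z≤n; s≤s; pred)
open import Data.Nat.Properties
open import Data.Nat.Combinatorics using (_C_; nCn≡1; nCk+nC[k+1]≡[n+1]C[k+1])
open import Data.Nat.Tactic.RingSolver using (solve-∀)
open import Data.Fin using (Fin; zero; suc; toℕ)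
open import Data.Fin.Properties using (toℕ≤n; +↔⊎)
open import Data.Vec using (Vec; []; _∷_; lookup; map)
import Data.Vec.Properties as Vec
open import Data.Product using (Σ; _×_; _,_; proj₁; ∃)
open import Data.Product.Properties using () renaming (≡-dec to ×-≡-dec)
open import Data.Sum using (_⊎_; inj₁; inj₂)
import Data.Sum as Sum
open import Data.Sum.Function.Propositional using (_⊎-↔_)
open import Data.Unit using (tt)
open import Data.Empty using (⊥-elim-irr)
open import Data.Irrelevant using (Irrelevant; [_])
open import Function using (_∘_)
open import Function.Bundles using (_↔_; mk↔ₛ′)
open import Function.Properties.Inverse using (↔-sym; ↔-trans)
open import Relation.Nullary using (yes; no; contradiction)
open import Relation.Nullary.Decidable using (recompute)
open import Relation.Binary.PropositionalEquality

private variable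
  b c k l m n p q A B i₀ j₀ x y : ℕ
  as : Vec ℕ m
  bs : Vec ℕ n
  X Y : Set

-- Binomial coefficients

-- binom m A = C(A + m, m) and binom⁻ m A = C(A + m, m - 1), defined through
-- Pascal's rule so that the recursions below hold definitionally.
binom : ℕ → ℕ → ℕ
binom zero    _       = 1
binom (suc m) zero    = 1
binom (suc m) (suc A) = binom m (suc A) + binom (suc m) A

binom⁻ : ℕ → ℕ → ℕ
binom⁻ zero    _ = 0
binom⁻ (suc m) A = binom m (suc A)

binom⁻-pascal : ∀ m A → binom⁻ (suc m) (suc A) ≡ binom⁻ m (suc A) + binom⁻ (suc m) A
binom⁻-pascal zero    A = refl
binom⁻-pascal (suc m) A = refl

binom-zeroʳ : ∀ m → binom m 0 ≡ 1
binom-zeroʳ zero    = refl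
binom-zeroʳ (suc m) = refl

binom-oneʳ : ∀ m → binom m 1 ≡ suc m
binom-oneʳ zero    = refl
binom-oneʳ (suc m) = trans (cong (_+ 1) (binom-oneʳ m)) (+-comm (suc m) 1)

binom≡C : ∀ m A → binom m A ≡ (A + m) C m
binom≡C zero    A       = refl
binom≡C (suc m) zero    = sym (nCn≡1 (suc m))
binom≡C (suc m) (suc A) = begin
  binom m (suc A) + binom (suc m) A      ≡⟨ cong₂ _+_ (binom≡C m (suc A)) (binom≡C (suc m) A) ⟩
  (suc A + m) C m + (A + suc m) C suc m  ≡⟨ cong (λ k → k C m + (A + suc m) C suc m) (sym (+-suc A m)) ⟩
  (A + suc m) C m + (A + suc m) C suc m  ≡⟨ nCk+nC[k+1]≡[n+1]C[k+1] (A + suc m) m ⟩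
  suc (A + suc m) C suc m                ∎
  where open ≡-Reasoning

m*binom≡[1+A]*binom⁻ : ∀ m A → m * binom m A ≡ suc A * binom⁻ m A
m*binom≡[1+A]*binom⁻ zero    A = sym (*-zeroʳ (suc A))
m*binom≡[1+A]*binom⁻ (suc m) zero rewrite binom-oneʳ m = *-comm (suc m) 1
m*binom≡[1+A]*binom⁻ (suc m) (suc A) = begin
  suc m * (P + binom (suc m) A)                ≡⟨ *-distribˡ-+ (suc m) P (binom (suc m) A) ⟩
  suc m * P + suc m * binom (suc m) A          ≡⟨ cong₂ _+_ (cong (P +_) (m*binom≡[1+A]*binom⁻ m (suc A)))
                                                            (m*binom≡[1+A]*binom⁻ (suc m) A) ⟩
  P + suc (suc A) * R + suc A * P              ≡⟨ regroup P R A ⟩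
  suc (suc A) * (R + P)                        ≡⟨ cong (suc (suc A) *_) (binom⁻-pascal m A) ⟨
  suc (suc A) * binom⁻ (suc m) (suc A)         ∎
  where
  open ≡-Reasoning
  P = binom m (suc A)
  R = binom⁻ m (suc A)
  regroup : ∀ p r a → p + suc (suc a) * r + suc a * p ≡ suc (suc a) * (r + p)
  regroup = solve-∀

nonDecreasing-tail : NonDecreasing (x ∷ as) → NonDecreasing as
nonDecreasing-tail {as = []}    _        = tt
nonDecreasing-tail {as = _ ∷ _} (_ , nd) = nd

nonDecreasing-cons-zero : NonDecreasing as → NonDecreasing (0 ∷ as)
nonDecreasing-cons-zero {as = []}    _  = tt
nonDecreasing-cons-zero {as = _ ∷ _} nd = z≤n , nd

nonDecreasing-map : ∀ (f : ℕ → ℕ) → (∀ {x y} → x ≤ y → f x ≤ f y) →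
                    NonDecreasing as → NonDecreasing (map f as)
nonDecreasing-map {as = []}        f f-mono _        = tt
nonDecreasing-map {as = _ ∷ []}    f f-mono _        = tt
nonDecreasing-map {as = _ ∷ _ ∷ _} f f-mono (x≤y , nd) = f-mono x≤y , nonDecreasing-map f f-mono nd

head≤lookup : NonDecreasing (x ∷ as) → ∀ i → x ≤ lookup (x ∷ as) i
head≤lookup                   _          zero    = ≤-refl
head≤lookup {as = _ ∷ _} (x≤y , nd) (suc i) = ≤-trans x≤y (head≤lookup nd i)

map-pred∘suc : ∀ (as : Vec ℕ m) → map pred (map suc as) ≡ as
map-pred∘suc as = trans (sym (Vec.map-∘ pred suc as)) (Vec.map-id as)

map-suc∘pred : NonDecreasing (suc x ∷ as) → map suc (map pred (suc x ∷ as)) ≡ suc x ∷ as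
map-suc∘pred {as = []}          _       = refl
map-suc∘pred {x} {as = suc y ∷ as} (_ , nd) = cong (suc x ∷_) (map-suc∘pred nd)

-- Admissible pairs

-- For A = b n and B = c m, cross says a_i ≤ b j or b_j ≤ c i, which is how
-- IPF^(2)_{m,n}(U) is described by ipf2↔admissible below.  Measuring n ∸ j and
-- m ∸ i from the far end makes dropping a first entry, or lowering all entries
-- of a sequence, change only the parameters m, n, A, B.
record IsAdmissible (b c A B : ℕ) {m n : ℕ} (as : Vec ℕ m) (bs : Vec ℕ n) : Set where
  field
    as-nonDecreasing : NonDecreasing as
    bs-nonDecreasing : NonDecreasing bs
    as≤A  : ∀ i → lookup as i ≤ A
    bs≤B  : ∀ j → lookup bs j ≤ B
    cross : ∀ i j → lookup as i + b * (n ∸ toℕ j) ≤ A ⊎ lookup bs j + c * (m ∸ toℕ i) ≤ B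
open IsAdmissible

isAdmissible-swap : IsAdmissible b c A B as bs → IsAdmissible c b B A bs as
isAdmissible-swap adm = record
  { as-nonDecreasing = bs-nonDecreasing adm
  ; bs-nonDecreasing = as-nonDecreasing adm
  ; as≤A  = bs≤B adm
  ; bs≤B  = as≤A adm
  ; cross = λ j i → Sum.swap (cross adm i j)
  }

isAdmissible-dropZeroˡ : IsAdmissible b c A B (0 ∷ as) bs → IsAdmissible b c A B as bs
isAdmissible-dropZeroˡ adm = record
  { as-nonDecreasing = nonDecreasing-tail (as-nonDecreasing adm)
  ; bs-nonDecreasing = bs-nonDecreasing adm
  ; as≤A  = as≤A adm ∘ suc
  ; bs≤B  = bs≤B adm
  ; cross = cross adm ∘ suc
  }

isAdmissible-consZeroˡ : {bs : Vec ℕ n} → b * n ≤ A →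
                         IsAdmissible b c A B as bs → IsAdmissible b c A B (0 ∷ as) bs
isAdmissible-consZeroˡ {n} {b} bn≤A adm = record
  { as-nonDecreasing = nonDecreasing-cons-zero (as-nonDecreasing adm)
  ; bs-nonDecreasing = bs-nonDecreasing adm
  ; as≤A  = λ { zero → z≤n ; (suc i) → as≤A adm i }
  ; bs≤B  = bs≤B adm
  ; cross = λ { zero j → inj₁ (≤-trans (*-monoʳ-≤ b (m∸n≤m n (toℕ j))) bn≤A)
              ; (suc i) j → cross adm i j }
  }

isAdmissible-dropZeroʳ : IsAdmissible b c A B as (0 ∷ bs) → IsAdmissible b c A B as bs
isAdmissible-dropZeroʳ = isAdmissible-swap ∘ isAdmissible-dropZeroˡ ∘ isAdmissible-swap

isAdmissible-consZeroʳ : {as : Vec ℕ m} → c * m ≤ B →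
                         IsAdmissible b c A B as bs → IsAdmissible b c A B as (0 ∷ bs)
isAdmissible-consZeroʳ cm≤B = isAdmissible-swap ∘ isAdmissible-consZeroˡ cm≤B ∘ isAdmissible-swap

isAdmissible-mapˡ : ∀ {A′} (f : ℕ → ℕ) → (∀ {x y} → x ≤ y → f x ≤ f y) →
                    (∀ i {k} → lookup as i + k ≤ A → f (lookup as i) + k ≤ A′) →
                    IsAdmissible b c A B as bs → IsAdmissible b c A′ B (map f as) bs
isAdmissible-mapˡ {as = as} {A = A} {A′ = A′} f f-mono f-shift adm = record
  { as-nonDecreasing = nonDecreasing-map f f-mono (as-nonDecreasing adm)
  ; bs-nonDecreasing = bs-nonDecreasing adm
  ; as≤A  = λ i →
      m+n≤o⇒m≤o _ (lookup-map (f-shift i (≤-trans (≤-reflexive (+-identityʳ _)) (as≤A adm i))))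
  ; bs≤B  = bs≤B adm
  ; cross = λ i j → Sum.map₁ (lookup-map ∘ f-shift i) (cross adm i j)
  }
  where
  lookup-map : ∀ {i} → f (lookup as i) + k ≤ A′ → lookup (map f as) i + k ≤ A′
  lookup-map {k = k} {i = i} = subst (λ z → z + k ≤ A′) (sym (Vec.lookup-map i f as))

isAdmissible-raiseˡ : IsAdmissible b c A B as bs → IsAdmissible b c (suc A) B (map suc as) bs
isAdmissible-raiseˡ = isAdmissible-mapˡ suc s≤s (λ _ → s≤s)

isAdmissible-lowerˡ : IsAdmissible b c (suc A) B (suc x ∷ as) bs →
                      IsAdmissible b c A B (map pred (suc x ∷ as)) bs
isAdmissible-lowerˡ adm =
  isAdmissible-mapˡ pred pred-mono-≤ (λ i → pred-shift (head≤lookup (as-nonDecreasing adm) i)) adm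
  where
  pred-shift : suc x ≤ y → y + k ≤ suc A → pred y + k ≤ A
  pred-shift {y = suc y} _ (s≤s y+k≤A) = y+k≤A

Admissible : (b c m n A B : ℕ) → Set
Admissible b c m n A B =
  Σ (Vec ℕ m × Vec ℕ n) λ (as , bs) → Irrelevant (IsAdmissible b c A B as bs)

-- Pairs of vectors of naturals have decidable equality, so an irrelevant
-- proof of their equality suffices.
admissible-≡ : {u v : Admissible b c m n A B} → .(proj₁ u ≡ proj₁ v) → u ≡ v
admissible-≡ {u = ab , _} {v = ab′ , _} eq
  with recompute (×-≡-dec (Vec.≡-dec _≟_) (Vec.≡-dec _≟_) ab ab′) eq
... | refl = refl

swapPair : Admissible b c m n A B → Admissible c b n m B A
swapPair ((as , bs) , [ adm ]) = (bs , as) , [ isAdmissible-swap adm ]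

admissible-swap : Admissible b c m n A B ↔ Admissible c b n m B A
admissible-swap = mk↔ₛ′ swapPair swapPair (λ _ → refl) (λ _ → refl)

admissible-splitˡ : b * n ≤ A →
  Admissible b c (suc m) n (suc A) B ↔ (Admissible b c m n (suc A) B ⊎ Admissible b c (suc m) n A B)
admissible-splitˡ {b} {n} {A} {c} {m} {B} bn≤A = mk↔ₛ′ to from to∘from from∘to
  where
  to : Admissible b c (suc m) n (suc A) B → Admissible b c m n (suc A) B ⊎ Admissible b c (suc m) n A B
  to ((zero  ∷ as , bs) , [ adm ]) = inj₁ ((as , bs) , [ isAdmissible-dropZeroˡ adm ])
  to ((suc x ∷ as , bs) , [ adm ]) = inj₂ ((map pred (suc x ∷ as) , bs) , [ isAdmissible-lowerˡ adm ])
  from : Admissible b c m n (suc A) B ⊎ Admissible b c (suc m) n A B → Admissible b c (suc m) n (suc A) B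
  from (inj₁ ((as , bs) , [ adm ])) = (0 ∷ as , bs) , [ isAdmissible-consZeroˡ (m≤n⇒m≤1+n bn≤A) adm ]
  from (inj₂ ((as , bs) , [ adm ])) = (map suc as , bs) , [ isAdmissible-raiseˡ adm ]
  to∘from : ∀ w → to (from w) ≡ w
  to∘from (inj₁ _)                  = refl
  to∘from (inj₂ ((x ∷ as , bs) , _)) =
    cong inj₂ (admissible-≡ (cong (λ as′ → x ∷ as′ , bs) (map-pred∘suc as)))
  from∘to : ∀ w → from (to w) ≡ w
  from∘to ((zero  ∷ as , bs) , _)       = refl
  from∘to ((suc x ∷ as , bs) , [ adm ]) =
    admissible-≡ (cong (_, bs) (map-suc∘pred (as-nonDecreasing adm)))

admissible-zeroˡ : b * n ≤ 0 → Admissible b c (suc m) n 0 B ↔ Admissible b c m n 0 B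
admissible-zeroˡ {b} {n} {c} {m} {B} bn≤0 = mk↔ₛ′ to from (λ _ → refl) from∘to
  where
  to : Admissible b c (suc m) n 0 B → Admissible b c m n 0 B
  to ((zero  ∷ as , bs) , [ adm ]) = (as , bs) , [ isAdmissible-dropZeroˡ adm ]
  to ((suc _ ∷ _  , _)  , [ adm ]) = ⊥-elim-irr (n≮0 (as≤A adm zero))
  from : Admissible b c m n 0 B → Admissible b c (suc m) n 0 B
  from ((as , bs) , [ adm ]) = (0 ∷ as , bs) , [ isAdmissible-consZeroˡ bn≤0 adm ]
  from∘to : ∀ w → from (to w) ≡ w
  from∘to ((zero  ∷ _ , _) , _)       = refl
  from∘to ((suc _ ∷ _ , _) , [ adm ]) = ⊥-elim-irr (n≮0 (as≤A adm zero))

admissible-corner : b * suc n ≡ suc A → c * suc m ≡ suc B →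
  Admissible b c (suc m) (suc n) (suc A) (suc B) ↔
  (Admissible b c m (suc n) (suc A) (suc B) ⊎ Admissible b c (suc m) n A (suc B))
admissible-corner {b} {n} {A} {c} {m} {B} bn≡ cm≡ = mk↔ₛ′ to from to∘from from∘to
  where
  not-both-positive : {as : Vec ℕ m} {bs : Vec ℕ n} →
                      .(IsAdmissible b c (suc A) (suc B) (suc x ∷ as) (suc y ∷ bs)) → X
  not-both-positive {x} {y} adm = ⊥-elim-irr (too-big (cross adm zero zero))
    where
    too-big : suc x + b * suc n ≤ suc A ⊎ suc y + c * suc m ≤ suc B → _
    too-big (inj₁ h) = n≮0 (+-cancelʳ-≤ (suc A) (suc x) 0 (subst (λ k → suc x + k ≤ suc A) bn≡ h))
    too-big (inj₂ h) = n≮0 (+-cancelʳ-≤ (suc B) (suc y) 0 (subst (λ k → suc y + k ≤ suc B) cm≡ h))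
  to : Admissible b c (suc m) (suc n) (suc A) (suc B) →
       Admissible b c m (suc n) (suc A) (suc B) ⊎ Admissible b c (suc m) n A (suc B)
  to ((zero  ∷ as , bs)         , [ adm ]) = inj₁ ((as , bs) , [ isAdmissible-dropZeroˡ adm ])
  to ((suc x ∷ as , zero ∷ bs)  , [ adm ]) =
    inj₂ ((map pred (suc x ∷ as) , bs) , [ isAdmissible-lowerˡ (isAdmissible-dropZeroʳ adm) ])
  to ((suc _ ∷ _  , suc _ ∷ _)  , [ adm ]) = not-both-positive adm
  from : Admissible b c m (suc n) (suc A) (suc B) ⊎ Admissible b c (suc m) n A (suc B) →
         Admissible b c (suc m) (suc n) (suc A) (suc B)
  from (inj₁ ((as , bs) , [ adm ])) = (0 ∷ as , bs) , [ isAdmissible-consZeroˡ (≤-reflexive bn≡) adm ]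
  from (inj₂ ((as , bs) , [ adm ])) =
    (map suc as , 0 ∷ bs) , [ isAdmissible-consZeroʳ (≤-reflexive cm≡) (isAdmissible-raiseˡ adm) ]
  to∘from : ∀ w → to (from w) ≡ w
  to∘from (inj₁ _)                  = refl
  to∘from (inj₂ ((x ∷ as , bs) , _)) =
    cong inj₂ (admissible-≡ (cong (λ as′ → x ∷ as′ , bs) (map-pred∘suc as)))
  from∘to : ∀ w → from (to w) ≡ w
  from∘to ((zero  ∷ _  , _)        , _)       = refl
  from∘to ((suc x ∷ as , zero ∷ bs) , [ adm ]) =
    admissible-≡ (cong (_, zero ∷ bs) (map-suc∘pred (as-nonDecreasing adm)))
  from∘to ((suc _ ∷ _  , suc _ ∷ _) , [ adm ]) = not-both-positive adm

admissible-splitʳ : c * m ≤ B →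
  Admissible b c m (suc n) A (suc B) ↔ (Admissible b c m n A (suc B) ⊎ Admissible b c m (suc n) A B)
admissible-splitʳ cm≤B =
  ↔-trans admissible-swap (↔-trans (admissible-splitˡ cm≤B) (admissible-swap ⊎-↔ admissible-swap))

admissible-zeroʳ : c * m ≤ 0 → Admissible b c m (suc n) A 0 ↔ Admissible b c m n A 0
admissible-zeroʳ cm≤0 = ↔-trans admissible-swap (↔-trans (admissible-zeroˡ cm≤0) admissible-swap)

-- Counting

-- X has total ∸ excess elements; both summands are kept to avoid
-- truncated subtraction.
record Counted (X : Set) (total excess : ℕ) : Set where
  constructor counted
  field
    size              : ℕ
    enumeration       : Fin size ↔ X
    size+excess≡total : size + excess ≡ total

counted-↔ : X ↔ Y → Counted X k l → Counted Y k l
counted-↔ X↔Y (counted N enum eq) = counted N (↔-trans enum X↔Y) eq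

counted-cong : k ≡ p → l ≡ q → Counted X k l → Counted X p q
counted-cong refl refl cX = cX

counted-⊎ : ∀ {t₁ e₁ t₂ e₂} →
            Counted X t₁ e₁ → Counted Y t₂ e₂ → Counted (X ⊎ Y) (t₁ + t₂) (e₁ + e₂)
counted-⊎ (counted N enumX eqX) (counted M enumY eqY) =
  counted (N + M) (↔-trans +↔⊎ (enumX ⊎-↔ enumY)) (trans (+-exchange N M _ _) (cong₂ _+_ eqX eqY))
  where
  +-exchange : ∀ a b c d → (a + b) + (c + d) ≡ (a + c) + (b + d)
  +-exchange = solve-∀

counted-pad : ∀ k → Counted X p q → Counted X (p + k) (q + k)
counted-pad {q = q} k (counted N enum eq) = counted N enum (trans (sym (+-assoc N q k)) (cong (_+ k) eq))

data Slack (k : ℕ) : ℕ → Set where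
  zero-bound : k ≡ 0 → Slack k 0
  loose      : k ≤ A → Slack k (suc A)
  tight      : k ≡ suc A → Slack k (suc A)

slack : k ≤ A → Slack k A
slack {A = zero}  k≤0   = zero-bound (n≤0⇒n≡0 k≤0)
slack {A = suc A} k≤1+A with m≤n⇒m<n∨m≡n k≤1+A
... | inj₁ (s≤s k≤A) = loose k≤A
... | inj₂ k≡1+A     = tight k≡1+A

k*[1+n]≤A⇒k*n≤A : ∀ k n → k * suc n ≤ A → k * n ≤ A
k*[1+n]≤A⇒k*n≤A k n = ≤-trans (*-monoʳ-≤ k (n≤1+n n))

tight⇒≤ : ∀ k n → k * suc n ≡ suc A → k * n ≤ A
tight⇒≤ zero    n ()
tight⇒≤ (suc b) n bn≡ = subst (suc b * n ≤_) (suc-injective bn≡) (+-monoʳ-≤ n (*-monoʳ-≤ b (n≤1+n n)))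

total : ℕ → ℕ → ℕ → ℕ → ℕ
total m n A B = binom m A * binom n B

module _ (b c : ℕ) where

  excess : ℕ → ℕ → ℕ → ℕ → ℕ
  excess m n A B = binom⁻ m A * binom⁻ n B * (b * c)

  excess-scaled : ∀ m n A B → suc A * suc B * excess m n A B ≡ b * n * (c * m) * total m n A B
  excess-scaled m n A B = begin
    suc A * suc B * (binom⁻ m A * binom⁻ n B * (b * c))  ≡⟨ regroup (suc A) (suc B) (binom⁻ m A) (binom⁻ n B) b c ⟩
    b * c * (suc A * binom⁻ m A) * (suc B * binom⁻ n B)  ≡⟨ cong₂ (λ x y → b * c * x * y)
                                                               (m*binom≡[1+A]*binom⁻ m A) (m*binom≡[1+A]*binom⁻ n B) ⟨
    b * c * (m * binom m A) * (n * binom n B)            ≡⟨ regroup′ m n (binom m A) (binom n B) b c ⟩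
    b * n * (c * m) * (binom m A * binom n B)            ∎
    where
    open ≡-Reasoning
    regroup : ∀ a a′ r s b c → a * a′ * (r * s * (b * c)) ≡ b * c * (a * r) * (a′ * s)
    regroup = solve-∀
    regroup′ : ∀ m n p q b c → b * c * (m * p) * (n * q) ≡ b * n * (c * m) * (p * q)
    regroup′ = solve-∀

  counted-zeroˡ : ∀ m n B → b * n ≡ 0 →
    Counted X (total m n 0 B) (excess m n 0 B) → Counted X (total (suc m) n 0 B) (excess (suc m) n 0 B)
  counted-zeroˡ m n B bn≡0 =
    counted-cong (cong (_* binom n B) (binom-zeroʳ m)) (trans (vanishes m) (sym (vanishes (suc m))))
    where
    vanishes : ∀ m → excess m n 0 B ≡ 0
    vanishes m with m*n≡0⇒m≡0∨n≡0 b bn≡0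
    ... | inj₁ refl = *-zeroʳ (binom⁻ m 0 * binom⁻ n B)
    ... | inj₂ refl = cong (_* (b * c)) (*-zeroʳ (binom⁻ m 0))

  counted-zeroʳ : ∀ m n A → c * m ≡ 0 →
    Counted X (total m n A 0) (excess m n A 0) → Counted X (total m (suc n) A 0) (excess m (suc n) A 0)
  counted-zeroʳ m n A cm≡0 =
    counted-cong (cong (binom m A *_) (binom-zeroʳ n)) (trans (vanishes n) (sym (vanishes (suc n))))
    where
    vanishes : ∀ n → excess m n A 0 ≡ 0
    vanishes n with m*n≡0⇒m≡0∨n≡0 c cm≡0
    ... | inj₁ refl = trans (cong (binom⁻ m A * binom⁻ n 0 *_) (*-zeroʳ b)) (*-zeroʳ (binom⁻ m A * binom⁻ n 0))
    ... | inj₂ refl = refl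

  counted-pascalˡ : ∀ m n A B →
    Counted X (total m n (suc A) B) (excess m n (suc A) B) →
    Counted Y (total (suc m) n A B) (excess (suc m) n A B) →
    Counted (X ⊎ Y) (total (suc m) n (suc A) B) (excess (suc m) n (suc A) B)
  counted-pascalˡ m n A B cX cY = counted-cong
    (sym (*-distribʳ-+ (binom n B) (binom m (suc A)) (binom (suc m) A)))
    (trans (distrib (binom⁻ m (suc A)) (binom⁻ (suc m) A) (binom⁻ n B) (b * c))
           (cong (λ r → r * binom⁻ n B * (b * c)) (sym (binom⁻-pascal m A))))
    (counted-⊎ cX cY)
    where
    distrib : ∀ r₁ r₂ s x → r₁ * s * x + r₂ * s * x ≡ (r₁ + r₂) * s * x
    distrib = solve-∀

  counted-pascalʳ : ∀ m n A B →
    Counted X (total m n A (suc B)) (excess m n A (suc B)) →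
    Counted Y (total m (suc n) A B) (excess m (suc n) A B) →
    Counted (X ⊎ Y) (total m (suc n) A (suc B)) (excess m (suc n) A (suc B))
  counted-pascalʳ m n A B cX cY = counted-cong
    (sym (*-distribˡ-+ (binom m A) (binom n (suc B)) (binom (suc n) B)))
    (trans (distrib (binom⁻ m A) (binom⁻ n (suc B)) (binom⁻ (suc n) B) (b * c))
           (cong (λ s → binom⁻ m A * s * (b * c)) (sym (binom⁻-pascal n B))))
    (counted-⊎ cX cY)
    where
    distrib : ∀ r s₁ s₂ x → r * s₁ * x + r * s₂ * x ≡ r * (s₁ + s₂) * x
    distrib = solve-∀

  -- In the corner case the excess exactly makes up for the pairs with both
  -- first entries positive, which are not admissible.
  counted-corner : ∀ m n A B → b * suc n ≡ suc A → c * suc m ≡ suc B →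
    Counted X (total m (suc n) (suc A) (suc B)) (excess m (suc n) (suc A) (suc B)) →
    Counted Y (total (suc m) n A (suc B)) (excess (suc m) n A (suc B)) →
    Counted (X ⊎ Y) (total (suc m) (suc n) (suc A) (suc B)) (excess (suc m) (suc n) (suc A) (suc B))
  counted-corner m n A B bn≡ cm≡ cX cY = counted-cong
    (expand-total (binom m (suc A)) (binom (suc m) A) (binom n (suc B)) (binom (suc n) B))
    (begin
      excess m (suc n) (suc A) (suc B) + excess (suc m) n A (suc B) + total (suc m) (suc n) A B
        ≡⟨ cong₂ _+_ (cong (λ s → r₁ * s * (b * c) + excess (suc m) n A (suc B)) (binom⁻-pascal n B))
                     (sym excess≡total-missing) ⟩
      r₁ * (s₁ + s₂) * (b * c) + r₂ * s₁ * (b * c) + r₂ * s₂ * (b * c)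
        ≡⟨ expand-excess r₁ r₂ s₁ s₂ (b * c) ⟩
      (r₁ + r₂) * (s₁ + s₂) * (b * c)
        ≡⟨ cong₂ (λ r s → r * s * (b * c)) (binom⁻-pascal m A) (binom⁻-pascal n B) ⟨
      excess (suc m) (suc n) (suc A) (suc B) ∎)
    (counted-pad (total (suc m) (suc n) A B) (counted-⊎ cX cY))
    where
    open ≡-Reasoning
    r₁ = binom⁻ m (suc A)
    r₂ = binom⁻ (suc m) A
    s₁ = binom⁻ n (suc B)
    s₂ = binom⁻ (suc n) B
    excess≡total-missing : excess (suc m) (suc n) A B ≡ total (suc m) (suc n) A B
    excess≡total-missing = *-cancelˡ-≡ _ _ (suc A * suc B)
      (trans (excess-scaled (suc m) (suc n) A B) (cong₂ (λ x y → x * y * total (suc m) (suc n) A B) bn≡ cm≡))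
    expand-total : ∀ p₁ p₂ q₁ q₂ → p₁ * (q₁ + q₂) + p₂ * q₁ + p₂ * q₂ ≡ (p₁ + p₂) * (q₁ + q₂)
    expand-total = solve-∀
    expand-excess : ∀ r₁ r₂ s₁ s₂ x →
      r₁ * (s₁ + s₂) * x + r₂ * s₁ * x + r₂ * s₂ * x ≡ (r₁ + r₂) * (s₁ + s₂) * x
    expand-excess = solve-∀

  count : ∀ m n A B → b * n ≤ A → c * m ≤ B → Counted (Admissible b c m n A B) (total m n A B) (excess m n A B)
  count m n A B bn≤A cm≤B with slack bn≤A | slack cm≤B
  count zero zero _ _ _ _ | _ | _ = counted 1 (mk↔ₛ′ (λ _ → ([] , []) , [ empty ]) (λ _ → zero)
    (λ { (([] , []) , _) → refl }) (λ { zero → refl })) refl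
    where
    empty : IsAdmissible b c A B [] []
    empty = record { as-nonDecreasing = tt ; bs-nonDecreasing = tt ; as≤A = λ () ; bs≤B = λ () ; cross = λ () }
  count (suc m) n .0 B _ cm≤B | zero-bound bn≡0 | _ =
    counted-↔ (↔-sym (admissible-zeroˡ (≤-reflexive bn≡0)))
      (counted-zeroˡ m n B bn≡0 (count m n 0 B (≤-reflexive bn≡0) (k*[1+n]≤A⇒k*n≤A c m cm≤B)))
  count m (suc n) A .0 bn≤A _ | _ | zero-bound cm≡0 =
    counted-↔ (↔-sym (admissible-zeroʳ (≤-reflexive cm≡0)))
      (counted-zeroʳ m n A cm≡0 (count m n A 0 (k*[1+n]≤A⇒k*n≤A b n bn≤A) (≤-reflexive cm≡0)))
  count (suc m) n .(suc A) B _ cm≤B | loose {A} bn≤A | _ =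
    counted-↔ (↔-sym (admissible-splitˡ bn≤A)) (counted-pascalˡ m n A B
      (count m n (suc A) B (m≤n⇒m≤1+n bn≤A) (k*[1+n]≤A⇒k*n≤A c m cm≤B))
      (count (suc m) n A B bn≤A cm≤B))
  count m (suc n) A .(suc B) bn≤A _ | _ | loose {B} cm≤B =
    counted-↔ (↔-sym (admissible-splitʳ cm≤B)) (counted-pascalʳ m n A B
      (count m n A (suc B) (k*[1+n]≤A⇒k*n≤A b n bn≤A) (m≤n⇒m≤1+n cm≤B))
      (count m (suc n) A B bn≤A cm≤B))
  count (suc m) (suc n) .(suc A) .(suc B) _ _ | tight {A} bn≡ | tight {B} cm≡ =
    counted-↔ (↔-sym (admissible-corner bn≡ cm≡)) (counted-corner m n A B bn≡ cm≡
      (count m (suc n) (suc A) (suc B) (≤-reflexive bn≡) (k*[1+n]≤A⇒k*n≤A c m (≤-reflexive cm≡)))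
      (count (suc m) n A (suc B) (tight⇒≤ b n bn≡) (≤-reflexive cm≡)))
  count (suc m) zero .(suc A) B _ _ | tight {A} b0≡ | _ = contradiction (trans (sym (*-zeroʳ b)) b0≡) 0≢1+n
  count zero (suc n) A .(suc B) _ _ | _ | tight {B} c0≡ = contradiction (trans (sym (*-zeroʳ c)) c0≡) 0≢1+n

-- Lattice paths

-- as and bs are the entries a_{i₀}, a_{i₀+1}, … and b_{j₀}, b_{j₀+1}, … left
-- to a path starting at (i₀ , j₀).
record PathCondition (b c i₀ j₀ : ℕ) {p q : ℕ} (as : Vec ℕ p) (bs : Vec ℕ q) : Set where
  field
    as≤  : ∀ i → lookup as i ≤ b * (j₀ + q)
    bs≤  : ∀ j → lookup bs j ≤ c * (i₀ + p)
    crossing : ∀ i j → lookup as i ≤ b * (j₀ + toℕ j) ⊎ lookup bs j ≤ c * (i₀ + toℕ i)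
open PathCondition

pathCondition-swap : PathCondition b c i₀ j₀ as bs → PathCondition c b j₀ i₀ bs as
pathCondition-swap pc = record { as≤ = bs≤ pc ; bs≤ = as≤ pc ; crossing = λ j i → Sum.swap (crossing pc i j) }

≤*-+-suc : ∀ k i l → x ≤ k * (suc i + l) → x ≤ k * (i + suc l)
≤*-+-suc {x} k i l = subst (λ z → x ≤ k * z) (sym (+-suc i l))

≤*-suc-+ : ∀ k i l → x ≤ k * (i + suc l) → x ≤ k * (suc i + l)
≤*-suc-+ {x} k i l = subst (λ z → x ≤ k * z) (+-suc i l)

≤*-+0 : ∀ k i → x ≤ k * (i + 0) → x ≤ k * i
≤*-+0 {x} k i = subst (λ z → x ≤ k * z) (+-identityʳ i)

pathCondition-east : {as : Vec ℕ p} {bs : Vec ℕ q} → x ≤ b * j₀ →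
  PathCondition b c (suc i₀) j₀ as bs → PathCondition b c i₀ j₀ (x ∷ as) bs
pathCondition-east {p} {q} {b = b} {j₀} {c} {i₀} x≤bj₀ pc = record
  { as≤ = λ { zero → ≤-trans x≤bj₀ (*-monoʳ-≤ b (m≤m+n j₀ q)) ; (suc i) → as≤ pc i }
  ; bs≤ = λ j → ≤*-+-suc c i₀ p (bs≤ pc j)
  ; crossing = λ { zero j → inj₁ (≤-trans x≤bj₀ (*-monoʳ-≤ b (m≤m+n j₀ (toℕ j))))
                 ; (suc i) j → Sum.map₂ (≤*-+-suc c i₀ (toℕ i)) (crossing pc i j) }
  }

pathCondition-east⁻¹ : {as : Vec ℕ p} →
  PathCondition b c i₀ j₀ (x ∷ as) bs → PathCondition b c (suc i₀) j₀ as bs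
pathCondition-east⁻¹ {p} {c = c} {i₀} pc = record
  { as≤ = as≤ pc ∘ suc
  ; bs≤ = λ j → ≤*-suc-+ c i₀ p (bs≤ pc j)
  ; crossing = λ i j → Sum.map₂ (≤*-suc-+ c i₀ (toℕ i)) (crossing pc (suc i) j)
  }

pathCondition-north : y ≤ c * i₀ → PathCondition b c i₀ (suc j₀) as bs → PathCondition b c i₀ j₀ as (y ∷ bs)
pathCondition-north y≤ci₀ = pathCondition-swap ∘ pathCondition-east y≤ci₀ ∘ pathCondition-swap

pathCondition-north⁻¹ : PathCondition b c i₀ j₀ as (y ∷ bs) → PathCondition b c i₀ (suc j₀) as bs
pathCondition-north⁻¹ = pathCondition-swap ∘ pathCondition-east⁻¹ ∘ pathCondition-swap

<+1⇒≤ : x < k + 1 → x ≤ k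
<+1⇒≤ {x} {k} x<k+1 = m<1+n⇒m≤n (subst (x <_) (+-comm k 1) x<k+1)

≤⇒<+1 : x ≤ k → x < k + 1
≤⇒<+1 {x} {k} x≤k = subst (x <_) (+-comm 1 k) (s≤s x≤k)

k*j+k*[n∸j]≡k*n : ∀ k {j n} → j ≤ n → k * j + k * (n ∸ j) ≡ k * n
k*j+k*[n∸j]≡k*n k {j} {n} j≤n = trans (sym (*-distribˡ-+ k j (n ∸ j))) (cong (k *_) (m+[n∸m]≡n j≤n))

x≤k*j⇒x+k*[n∸j]≤k*n : ∀ k {j n} → j ≤ n → x ≤ k * j → x + k * (n ∸ j) ≤ k * n
x≤k*j⇒x+k*[n∸j]≤k*n k j≤n x≤kj = ≤-trans (+-monoˡ-≤ _ x≤kj) (≤-reflexive (k*j+k*[n∸j]≡k*n k j≤n))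

x+k*[n∸j]≤k*n⇒x≤k*j : ∀ k {j n} → j ≤ n → x + k * (n ∸ j) ≤ k * n → x ≤ k * j
x+k*[n∸j]≤k*n⇒x≤k*j {x} k {j} {n} j≤n h =
  +-cancelʳ-≤ (k * (n ∸ j)) x (k * j) (≤-trans h (≤-reflexive (sym (k*j+k*[n∸j]≡k*n k j≤n))))

module _ {b c : ℕ} where

  private
    u v : ℕ → ℕ → ℕ
    u i j = b * j + 1
    v i j = c * i + 1

  boundedFrom⇒pathCondition : (as : Vec ℕ p) (bs : Vec ℕ q) (P : LPath p q) →
    BoundedFrom u v i₀ j₀ as bs P → PathCondition b c i₀ j₀ as bs
  boundedFrom⇒pathCondition [] [] done _ = record { as≤ = λ () ; bs≤ = λ () ; crossing = λ () }
  boundedFrom⇒pathCondition (x ∷ as) bs (east P) (x<u , bounded) =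
    pathCondition-east (<+1⇒≤ x<u) (boundedFrom⇒pathCondition as bs P bounded)
  boundedFrom⇒pathCondition [] (y ∷ bs) (north P) (y<v , bounded) =
    pathCondition-north (<+1⇒≤ y<v) (boundedFrom⇒pathCondition [] bs P bounded)
  boundedFrom⇒pathCondition (x ∷ as) (y ∷ bs) (north P) (y<v , bounded) =
    pathCondition-north (<+1⇒≤ y<v) (boundedFrom⇒pathCondition (x ∷ as) bs P bounded)

  boundedFrom-north : y ≤ c * i₀ → ∃ (BoundedFrom u v i₀ (suc j₀) as bs) → ∃ (BoundedFrom u v i₀ j₀ as (y ∷ bs))
  boundedFrom-north {as = []}    y≤ci₀ (P , bounded) = north P , ≤⇒<+1 y≤ci₀ , bounded
  boundedFrom-north {as = _ ∷ _} y≤ci₀ (P , bounded) = north P , ≤⇒<+1 y≤ci₀ , bounded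

  pathCondition⇒boundedFrom : (as : Vec ℕ p) (bs : Vec ℕ q) →
    PathCondition b c i₀ j₀ as bs → ∃ (BoundedFrom u v i₀ j₀ as bs)
  pathCondition⇒boundedFrom [] [] _ = done , tt
  pathCondition⇒boundedFrom {i₀ = i₀} [] (y ∷ bs) pc =
    boundedFrom-north (≤*-+0 c i₀ (bs≤ pc zero)) (pathCondition⇒boundedFrom [] bs (pathCondition-north⁻¹ pc))
  pathCondition⇒boundedFrom {i₀ = i₀} {j₀} (x ∷ as) bs pc with x ≤? b * j₀
  ... | yes x≤bj₀ =
    let P , bounded = pathCondition⇒boundedFrom as bs (pathCondition-east⁻¹ pc) in east P , ≤⇒<+1 x≤bj₀ , bounded
  ... | no x≰bj₀ with bs
  ...   | [] = contradiction (≤*-+0 b j₀ (as≤ pc zero)) x≰bj₀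
  ...   | y ∷ bs with crossing pc zero zero
  ...     | inj₁ x≤ = contradiction (≤*-+0 b j₀ x≤) x≰bj₀
  ...     | inj₂ y≤ = boundedFrom-north (≤*-+0 c i₀ y≤)
                        (pathCondition⇒boundedFrom (x ∷ as) bs (pathCondition-north⁻¹ pc))

  isIPF2⇒isAdmissible : {as : Vec ℕ m} {bs : Vec ℕ n} → IsIPF2 u v as bs → IsAdmissible b c (b * n) (c * m) as bs
  isIPF2⇒isAdmissible {as = as} {bs = bs} (as↑ , bs↑ , P , bounded) = record
    { as-nonDecreasing = as↑
    ; bs-nonDecreasing = bs↑
    ; as≤A  = as≤ pc
    ; bs≤B  = bs≤ pc
    ; cross = λ i j → Sum.map (x≤k*j⇒x+k*[n∸j]≤k*n b (toℕ≤n j)) (x≤k*j⇒x+k*[n∸j]≤k*n c (toℕ≤n i))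
                              (crossing pc i j)
    }
    where pc = boundedFrom⇒pathCondition as bs P bounded

  isAdmissible⇒isIPF2 : {as : Vec ℕ m} {bs : Vec ℕ n} → IsAdmissible b c (b * n) (c * m) as bs → IsIPF2 u v as bs
  isAdmissible⇒isIPF2 {as = as} {bs = bs} adm =
    as-nonDecreasing adm , bs-nonDecreasing adm , pathCondition⇒boundedFrom as bs (record
      { as≤ = as≤A adm
      ; bs≤ = bs≤B adm
      ; crossing = λ i j → Sum.map (x+k*[n∸j]≤k*n⇒x≤k*j b (toℕ≤n j)) (x+k*[n∸j]≤k*n⇒x≤k*j c (toℕ≤n i))
                                   (cross adm i j)
      })

  ipf2↔admissible : IPF2 m n u v ↔ Admissible b c m n (b * n) (c * m)
  ipf2↔admissible = mk↔ₛ′ (λ { (ab , [ ipf ]) → ab , [ isIPF2⇒isAdmissible ipf ] })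
                          (λ { (ab , [ adm ]) → ab , [ isAdmissible⇒isIPF2 adm ] })
                          (λ _ → refl) (λ _ → refl)

size-from-excess : ∀ N E T A B → N + E ≡ T → suc A * suc B * E ≡ A * B * T →
                   N * (suc A * suc B) ≡ (suc A + B) * T
size-from-excess N E T A B N+E≡T scaled = +-cancelʳ-≡ (A * B * T) _ _ (begin
  N * (suc A * suc B) + A * B * T          ≡⟨ cong (N * (suc A * suc B) +_) scaled ⟨
  N * (suc A * suc B) + suc A * suc B * E  ≡⟨ factor N E (suc A * suc B) ⟩
  suc A * suc B * (N + E)                  ≡⟨ cong (suc A * suc B *_) N+E≡T ⟩
  suc A * suc B * T                        ≡⟨ expand A B T ⟩
  (suc A + B) * T + A * B * T              ∎)
  where
  open ≡-Reasoning
  factor : ∀ n e p → n * p + p * e ≡ p * (n + e)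
  factor = solve-∀
  expand : ∀ a b t → suc a * suc b * t ≡ (suc a + b) * t + a * b * t
  expand = solve-∀

corollary14 : (m n b c : ℕ) → 1 ≤ m → 1 ≤ n →
    Σ ℕ (λ N → (Fin N ↔ IPF2 m n (λ i j → b * j + 1) (λ i j → c * i + 1))
      × (N * ((1 + b * n) * (1 + c * m))
          ≡ (1 + b * n + c * m) * (((b * n + m) C m) * ((c * m + n) C n))))
corollary14 m n b c _ _ = size , ↔-trans enumeration (↔-sym ipf2↔admissible) , (begin
  size * ((1 + b * n) * (1 + c * m))
    ≡⟨ size-from-excess size (excess b c m n (b * n) (c * m)) (total m n (b * n) (c * m)) (b * n) (c * m)
                        size+excess≡total (excess-scaled b c m n (b * n) (c * m)) ⟩
  (1 + b * n + c * m) * (binom m (b * n) * binom n (c * m))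
    ≡⟨ cong₂ (λ x y → (1 + b * n + c * m) * (x * y)) (binom≡C m (b * n)) (binom≡C n (c * m)) ⟩
  (1 + b * n + c * m) * (((b * n + m) C m) * ((c * m + n) C n)) ∎)
  where
  open ≡-Reasoning
  open Counted (count b c m n (b * n) (c * m) ≤-refl ≤-refl)
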